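{- For an integer $q\geq 2$ and arbitrary positive integers $c$ and $d$, $$P\big(S(c,\underbrace{d,\dots,d}_{q}),\lambda\big)=\mathbf{P}_d^{\,q-1}\left(\mathbf{P}_{c+d+1}-(q-1)\mathbf{P}_c\mathbf{P}_{d-1}\right).$$
   Context: For a graph $G$, $P(G,\lambda)=\det(\lambda I-A(G))$ is the characteristic polynomial of its adjacency matrix. $\mathbf{P}_m$ denotes $P(P_m,\lambda)$, the characteristic polynomial of the path $P_m$ on $m$ vertices, with the convention $\mathbf{P}_0=1$. For positive integers $c_1,\dots,c_r$, $S(c_1,\dots,c_r)$ is the starlike tree obtained from the disjoint union of paths $P_{c_1+1},\dots,P_{c_r+1}$ by identifying one end vertex of each path into a single vertex (the center); its branches are paths of lengths $c_1,\dots,c_r$. -}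

module Defs where

open import Data.Nat as ℕ using (ℕ; zero; suc; _∸_; _≡ᵇ_)
open import Data.Integer as ℤ using (ℤ; +_; _*_; _-_; _+_)
open import Data.Fin using (Fin; zero; suc; toℕ; punchIn)
open import Data.List using (List; []; _∷_; _++_)
open import Data.Bool.ListAction using (any)
open import Data.Nat.ListAction using (sum)
open import Data.Product using (_×_; _,_)
open import Data.Bool using (Bool; true; false; _∧_; _∨_; if_then_else_)

Matrix : ℕ → Set
Matrix n = Fin n → Fin n → ℤ

∑ : (n : ℕ) → (Fin n → ℤ) → ℤ
∑ zero    f = + 0
∑ (suc n) f = f zero + ∑ n (λ j → f (suc j))

sign : ℕ → ℤ
sign zero          = + 1
sign (suc zero)    = ℤ.- (+ 1)
sign (suc (suc k)) = sign k

minor : ∀ {n} → Matrix (suc n) → Fin (suc n) → Matrix n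
minor M j r s = M (suc r) (punchIn j s)

det : (n : ℕ) → Matrix n → ℤ
det zero    M = + 1
det (suc n) M = ∑ (suc n) (λ j → sign (toℕ j) * (M zero j * det n (minor M j)))

-- A finite simple graph on vertices 0..n-1, given by an (undirected) edge list.
record Graph : Set where
  constructor graph
  field
    order : ℕ
    edges : List (ℕ × ℕ)
open Graph public

isEdge : List (ℕ × ℕ) → ℕ → ℕ → Bool
isEdge es i j = any (λ { (a , b) → ((a ≡ᵇ i) ∧ (b ≡ᵇ j)) ∨ ((a ≡ᵇ j) ∧ (b ≡ᵇ i)) }) es

adj : (G : Graph) → Matrix (order G)
adj G i j = if isEdge (edges G) (toℕ i) (toℕ j) then + 1 else + 0

δ : ∀ {n} → Fin n → Fin n → ℤ
δ zero    zero    = + 1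
δ zero    (suc _) = + 0
δ (suc _) zero    = + 0
δ (suc i) (suc j) = δ i j

-- Characteristic polynomial P(G, λ) = det(λI - A(G)), evaluated at λ ∈ ℤ.
charPoly : Graph → ℤ → ℤ
charPoly G x = det (order G) (λ i j → x * δ i j - adj G i j)

pathEdgesFrom : ℕ → ℕ → ℕ → List (ℕ × ℕ)
pathEdgesFrom p s zero    = []
pathEdgesFrom p s (suc c) = (p , s) ∷ pathEdgesFrom s (suc s) c

pathGraph : ℕ → Graph
pathGraph m = graph m (pathEdgesFrom 0 1 (m ∸ 1))

-- 𝐏_m evaluated at λ (𝐏_0 = 1 since the empty determinant is 1).
𝐏 : ℕ → ℤ → ℤ
𝐏 m = charPoly (pathGraph m)

starEdges : ℕ → List ℕ → List (ℕ × ℕ)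
starEdges s []       = []
starEdges s (c ∷ cs) = pathEdgesFrom 0 s c ++ starEdges (s ℕ.+ c) cs

-- Starlike tree S(c₁,…,c_r): center 0, branches of lengths c₁,…,c_r.
starlike : List ℕ → Graph
starlike cs = graph (suc (sum cs)) (starEdges 1 cs)

-- With the centre as vertex 0, λI − A(S(c₁,…,c_r)) borders the block-diagonal matrix ⊕ᵢ (λI − A(P_{cᵢ}))
-- by a row and a column that are −1 exactly at the first vertex of each branch. Expanding along the centre
-- row, the diagonal entry contributes λ ∏ᵢ 𝐏_{cᵢ}; the entry at the first vertex of branch i contributes
-- −𝐏_{cᵢ−1} ∏_{k≠i} 𝐏_{c_k}, because in its minor the rows of branch i meet only the columns of branch i
-- and the centre. For S(c, d, …, d) this gives 𝐏_d^{q−1} ((λ𝐏_c − 𝐏_{c−1}) 𝐏_d − q 𝐏_c 𝐏_{d−1}), and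
-- the path identity 𝐏_{a+b} = 𝐏_a 𝐏_b − 𝐏_{a−1} 𝐏_{b−1} with a = c + 1, b = d turns it into the claim.
module Submission where

open import Defs
open import Data.Nat using (ℕ; _≤_; _+_; _∸_)
open import Data.Integer using (ℤ; +_; _*_; _-_; _^_)
open import Data.List using (_∷_; replicate)
open import Relation.Binary.PropositionalEquality using (_≡_)

open import Data.Bool using (Bool; true; false; _∨_; _∧_; if_then_else_)
import Data.Bool.Properties as Boolₚ
open import Data.Empty using (⊥-elim)
open import Data.Fin as Fin using (Fin; toℕ; punchIn)
open import Data.Integer using (-_; -1ℤ) renaming (_+_ to _+ℤ_)
import Data.Integer.Properties as ℤₚ
open import Data.Integer.Tactic.RingSolver using (solve-∀)
open import Data.List as List using (List; []; _++_)
import Data.List.Properties as List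
open import Data.Nat using (zero; suc; z≤n; s≤s; _<_; pred; _≡ᵇ_; _≟_)
import Data.Nat.Properties as ℕₚ
open import Data.Nat.ListAction using (sum)
open import Data.Product as Product using (∃-syntax; _×_; _,_)
open import Data.Sum using (_⊎_; inj₁; inj₂)
open import Relation.Binary.PropositionalEquality
  using (refl; sym; trans; cong; cong₂; subst; _≢_; module ≡-Reasoning)
open import Relation.Nullary using (yes; no)
open import Algebra.Properties.CommutativeSemigroup ℤₚ.+-commutativeSemigroup using (interchange)
import Algebra.Properties.CommutativeSemigroup ℕₚ.+-commutativeSemigroup as ℕ+
import Algebra.Properties.CommutativeSemigroup ℤₚ.*-commutativeSemigroup as ℤ*

-- Matrices are indexed by ℕ from here on, so that block offsets such as c + i can appear in patterns;
-- det≡detℕ transfers the result back to the Fin-indexed det.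
∑ℕ : ℕ → (ℕ → ℤ) → ℤ
∑ℕ zero    f = + 0
∑ℕ (suc n) f = f 0 +ℤ ∑ℕ n (λ j → f (suc j))

∑ℕ-cong : ∀ n {f g : ℕ → ℤ} → (∀ j → j < n → f j ≡ g j) → ∑ℕ n f ≡ ∑ℕ n g
∑ℕ-cong zero    eq = refl
∑ℕ-cong (suc n) eq = cong₂ _+ℤ_ (eq 0 (s≤s z≤n)) (∑ℕ-cong n (λ j j<n → eq (suc j) (s≤s j<n)))

∑ℕ-zero : ∀ n {f : ℕ → ℤ} → (∀ j → j < n → f j ≡ + 0) → ∑ℕ n f ≡ + 0
∑ℕ-zero zero    eq = refl
∑ℕ-zero (suc n) eq = cong₂ _+ℤ_ (eq 0 (s≤s z≤n)) (∑ℕ-zero n (λ j j<n → eq (suc j) (s≤s j<n)))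

∑ℕ-distrib-+ : ∀ n (f g : ℕ → ℤ) → ∑ℕ n (λ j → f j +ℤ g j) ≡ ∑ℕ n f +ℤ ∑ℕ n g
∑ℕ-distrib-+ zero    f g = refl
∑ℕ-distrib-+ (suc n) f g =
  trans (cong (f 0 +ℤ g 0 +ℤ_) (∑ℕ-distrib-+ n _ _)) (interchange (f 0) (g 0) _ _)

∑ℕ-*ˡ : ∀ n a (f : ℕ → ℤ) → ∑ℕ n (λ j → a * f j) ≡ a * ∑ℕ n f
∑ℕ-*ˡ zero    a f = sym (ℤₚ.*-zeroʳ a)
∑ℕ-*ˡ (suc n) a f = trans (cong (a * f 0 +ℤ_) (∑ℕ-*ˡ n a _)) (sym (ℤₚ.*-distribˡ-+ a (f 0) _))

∑ℕ-split : ∀ a b (f : ℕ → ℤ) → ∑ℕ (a + b) f ≡ ∑ℕ a f +ℤ ∑ℕ b (λ t → f (a + t))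
∑ℕ-split zero    b f = sym (ℤₚ.+-identityˡ _)
∑ℕ-split (suc a) b f = trans (cong (f 0 +ℤ_) (∑ℕ-split a b _)) (sym (ℤₚ.+-assoc (f 0) _ _))

punchInℕ : ℕ → ℕ → ℕ
punchInℕ zero    s       = suc s
punchInℕ (suc j) zero    = zero
punchInℕ (suc j) (suc s) = suc (punchInℕ j s)

toℕ-punchIn : ∀ {n} (j : Fin (suc n)) (s : Fin n) → toℕ (punchIn j s) ≡ punchInℕ (toℕ j) (toℕ s)
toℕ-punchIn Fin.zero    s           = refl
toℕ-punchIn (Fin.suc j) Fin.zero    = refl
toℕ-punchIn (Fin.suc j) (Fin.suc s) = cong suc (toℕ-punchIn j s)

Matℕ : Set
Matℕ = ℕ → ℕ → ℤ

minorℕ : Matℕ → ℕ → Matℕ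
minorℕ M j i s = M (suc i) (punchInℕ j s)

detℕ : ℕ → Matℕ → ℤ
detℕ zero    M = + 1
detℕ (suc n) M = ∑ℕ (suc n) (λ j → sign j * (M 0 j * detℕ n (minorℕ M j)))

detℕ-cong : ∀ n {M N : Matℕ} → (∀ i j → M i j ≡ N i j) → detℕ n M ≡ detℕ n N
detℕ-cong zero    eq = refl
detℕ-cong (suc n) eq = ∑ℕ-cong (suc n) λ j _ →
  cong (sign j *_) (cong₂ _*_ (eq 0 j) (detℕ-cong n (λ i s → eq (suc i) (punchInℕ j s))))

∑-cong : ∀ n {f g : Fin n → ℤ} → (∀ j → f j ≡ g j) → ∑ n f ≡ ∑ n g
∑-cong zero    eq = refl
∑-cong (suc n) eq = cong₂ _+ℤ_ (eq Fin.zero) (∑-cong n (λ j → eq (Fin.suc j)))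

∑≡∑ℕ : ∀ n (f : ℕ → ℤ) → ∑ n (λ j → f (toℕ j)) ≡ ∑ℕ n f
∑≡∑ℕ zero    f = refl
∑≡∑ℕ (suc n) f = cong (f 0 +ℤ_) (∑≡∑ℕ n (λ j → f (suc j)))

det-cong : ∀ n {M N : Matrix n} → (∀ i j → M i j ≡ N i j) → det n M ≡ det n N
det-cong zero    eq = refl
det-cong (suc n) eq = ∑-cong (suc n) λ j →
  cong (sign (toℕ j) *_) (cong₂ _*_ (eq Fin.zero j) (det-cong n (λ r s → eq (Fin.suc r) (punchIn j s))))

det≡detℕ : ∀ n (M : Matℕ) → det n (λ i j → M (toℕ i) (toℕ j)) ≡ detℕ n M
det≡detℕ zero    M = refl
det≡detℕ (suc n) M =
  trans (∑-cong (suc n) λ j →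
          cong (λ d → sign (toℕ j) * (M 0 (toℕ j) * d))
            (trans (det-cong n (λ r s → cong (M (suc (toℕ r))) (toℕ-punchIn j s)))
                   (det≡detℕ n (minorℕ M (toℕ j)))))
        (∑≡∑ℕ (suc n) (λ j → sign j * (M 0 j * detℕ n (minorℕ M j))))

sign-suc : ∀ k → sign (suc k) ≡ - sign k
sign-suc zero          = refl
sign-suc (suc zero)    = refl
sign-suc (suc (suc k)) = sign-suc k

sign*sign : ∀ k → sign k * sign k ≡ + 1
sign*sign zero          = refl
sign*sign (suc zero)    = refl
sign*sign (suc (suc k)) = sign*sign k

product≡0ˡ : ∀ {a} b → a ≡ + 0 → a * b ≡ + 0
product≡0ˡ b refl = ℤₚ.*-zeroˡ b

term≡0-entry : ∀ s {a} b → a ≡ + 0 → s * (a * b) ≡ + 0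
term≡0-entry s b refl = trans (cong (s *_) (ℤₚ.*-zeroˡ b)) (ℤₚ.*-zeroʳ s)

term≡0-minor : ∀ s a {b} → b ≡ + 0 → s * (a * b) ≡ + 0
term≡0-minor s a refl = trans (cong (s *_) (ℤₚ.*-zeroʳ a)) (ℤₚ.*-zeroʳ s)

detℕ-zero-column₀ : ∀ {n} (M : Matℕ) → 0 < n → (∀ i → M i 0 ≡ + 0) → detℕ n M ≡ + 0
detℕ-zero-column₀ {suc n} M _ col₀ = ∑ℕ-zero (suc n) term
  where
  term : ∀ j → j < suc n → sign j * (M 0 j * detℕ n (minorℕ M j)) ≡ + 0
  term zero    _         = term≡0-entry (sign 0) _ (col₀ 0)
  term (suc j) (s≤s j<n) = term≡0-minor (sign (suc j)) (M 0 (suc j))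
    (detℕ-zero-column₀ (minorℕ M (suc j)) (ℕₚ.≤-trans (s≤s z≤n) j<n) (λ i → col₀ (suc i)))

-- Expanding along row 0 and, by induction, every minor along its column 0 leaves only the pivot M r 0.
detℕ-column₀-single : ∀ r n (M : Matℕ) → r < suc n → (∀ i → i ≢ r → M i 0 ≡ + 0) →
  detℕ (suc n) M ≡ sign r * (M r 0 * detℕ n (λ i s → M (punchInℕ r i) (suc s)))
detℕ-column₀-single zero n M _ off =
  trans (cong (sign 0 * (M 0 0 * detℕ n (minorℕ M 0)) +ℤ_) (∑ℕ-zero n rest≡0)) (ℤₚ.+-identityʳ _)
  where
  rest≡0 : ∀ j → j < n → sign (suc j) * (M 0 (suc j) * detℕ n (minorℕ M (suc j))) ≡ + 0
  rest≡0 j j<n = term≡0-minor (sign (suc j)) (M 0 (suc j))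
    (detℕ-zero-column₀ (minorℕ M (suc j)) (ℕₚ.≤-trans (s≤s z≤n) j<n) (λ i → off (suc i) λ ()))
detℕ-column₀-single (suc r) (suc n) M (s≤s r<n) off =
  begin
    sign 0 * (M 0 0 * detℕ (suc n) (minorℕ M 0))
      +ℤ ∑ℕ (suc n) (λ j → term j (detℕ (suc n) (minorℕ M (suc j))))
  ≡⟨ cong₂ _+ℤ_ (term≡0-entry (sign 0) (detℕ (suc n) (minorℕ M 0)) (off 0 λ ()))
                (∑ℕ-cong (suc n) λ j _ → cong (term j) (expand j)) ⟩
    + 0 +ℤ ∑ℕ (suc n) (λ j → term j (sign r * (M (suc r) 0 * E j)))
  ≡⟨ ℤₚ.+-identityˡ _ ⟩
    ∑ℕ (suc n) (λ j → term j (sign r * (M (suc r) 0 * E j)))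
  ≡⟨ ∑ℕ-cong (suc n) (λ j _ → move-pivot j) ⟩
    ∑ℕ (suc n) (λ j → (sign (suc r) * M (suc r) 0) * (sign j * (M 0 (suc j) * E j)))
  ≡⟨ ∑ℕ-*ˡ (suc n) (sign (suc r) * M (suc r) 0) (λ j → sign j * (M 0 (suc j) * E j)) ⟩
    (sign (suc r) * M (suc r) 0) * ∑ℕ (suc n) (λ j → sign j * (M 0 (suc j) * E j))
  ≡⟨ ℤₚ.*-assoc (sign (suc r)) (M (suc r) 0) _ ⟩
    sign (suc r) * (M (suc r) 0 * detℕ (suc n) (λ i s → M (punchInℕ (suc r) i) (suc s)))
  ∎
  where
  open ≡-Reasoning
  term : ℕ → ℤ → ℤ
  term j d = sign (suc j) * (M 0 (suc j) * d)
  E : ℕ → ℤ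
  E j = detℕ n (λ i s → M (suc (punchInℕ r i)) (suc (punchInℕ j s)))
  expand : ∀ j → detℕ (suc n) (minorℕ M (suc j)) ≡ sign r * (M (suc r) 0 * E j)
  expand j = detℕ-column₀-single r n (minorℕ M (suc j)) r<n
    (λ i i≢r → off (suc i) (λ eq → i≢r (ℕₚ.suc-injective eq)))
  move-pivot : ∀ j → term j (sign r * (M (suc r) 0 * E j))
                     ≡ (sign (suc r) * M (suc r) 0) * (sign j * (M 0 (suc j) * E j))
  move-pivot j rewrite sign-suc j | sign-suc r = shuffle (sign j) (sign r) (M 0 (suc j)) (M (suc r) 0) (E j)
    where
    shuffle : ∀ sj sr a f e → (- sj) * (a * (sr * (f * e))) ≡ ((- sr) * f) * (sj * (a * e))
    shuffle = solve-∀

detℕ-column₀-additive : ∀ {n} (F G H : Matℕ) → 0 < n → (∀ i → F i 0 ≡ G i 0 +ℤ H i 0) →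
  (∀ i s → F i (suc s) ≡ G i (suc s)) → (∀ i s → F i (suc s) ≡ H i (suc s)) →
  detℕ n F ≡ detℕ n G +ℤ detℕ n H
detℕ-column₀-additive {suc n} F G H _ col₀ colG colH =
  begin
    term F 0 +ℤ ∑ℕ n (λ j → term F (suc j))
  ≡⟨ cong₂ _+ℤ_ first (trans (∑ℕ-cong n rest) (∑ℕ-distrib-+ n _ _)) ⟩
    (term G 0 +ℤ term H 0) +ℤ (∑ℕ n (λ j → term G (suc j)) +ℤ ∑ℕ n (λ j → term H (suc j)))
  ≡⟨ interchange (term G 0) (term H 0) _ _ ⟩
    (term G 0 +ℤ ∑ℕ n (λ j → term G (suc j))) +ℤ (term H 0 +ℤ ∑ℕ n (λ j → term H (suc j)))
  ∎
  where
  open ≡-Reasoning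
  term : Matℕ → ℕ → ℤ
  term M j = sign j * (M 0 j * detℕ n (minorℕ M j))
  minorG≡minorH : detℕ n (minorℕ G 0) ≡ detℕ n (minorℕ H 0)
  minorG≡minorH = detℕ-cong n (λ i s → trans (sym (colG (suc i) s)) (colH (suc i) s))
  first : term F 0 ≡ term G 0 +ℤ term H 0
  first =
    begin
      + 1 * (F 0 0 * detℕ n (minorℕ F 0))
    ≡⟨ cong₂ (λ a d → + 1 * (a * d)) (col₀ 0) (detℕ-cong n (λ i s → colG (suc i) s)) ⟩
      + 1 * ((G 0 0 +ℤ H 0 0) * detℕ n (minorℕ G 0))
    ≡⟨ ℤₚ.*-identityˡ _ ⟩
      (G 0 0 +ℤ H 0 0) * detℕ n (minorℕ G 0)
    ≡⟨ ℤₚ.*-distribʳ-+ _ (G 0 0) (H 0 0) ⟩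
      G 0 0 * detℕ n (minorℕ G 0) +ℤ H 0 0 * detℕ n (minorℕ G 0)
    ≡⟨ cong₂ _+ℤ_ (sym (ℤₚ.*-identityˡ (G 0 0 * detℕ n (minorℕ G 0))))
                  (trans (cong (H 0 0 *_) minorG≡minorH) (sym (ℤₚ.*-identityˡ (H 0 0 * detℕ n (minorℕ H 0))))) ⟩
      term G 0 +ℤ term H 0
    ∎
  rest : ∀ j → j < n → term F (suc j) ≡ term G (suc j) +ℤ term H (suc j)
  rest j j<n =
    begin
      sign (suc j) * (F 0 (suc j) * detℕ n (minorℕ F (suc j)))
    ≡⟨ cong (λ d → sign (suc j) * (F 0 (suc j) * d))
         (detℕ-column₀-additive (minorℕ F (suc j)) (minorℕ G (suc j)) (minorℕ H (suc j))
           (ℕₚ.≤-trans (s≤s z≤n) j<n) (λ i → col₀ (suc i))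
           (λ i s → colG (suc i) (punchInℕ j s)) (λ i s → colH (suc i) (punchInℕ j s))) ⟩
      sign (suc j) * (F 0 (suc j) * (detℕ n (minorℕ G (suc j)) +ℤ detℕ n (minorℕ H (suc j))))
    ≡⟨ distrib (sign (suc j)) (F 0 (suc j)) _ _ ⟩
      sign (suc j) * (F 0 (suc j) * detℕ n (minorℕ G (suc j)))
        +ℤ sign (suc j) * (F 0 (suc j) * detℕ n (minorℕ H (suc j)))
    ≡⟨ cong₂ (λ g h → sign (suc j) * (g * detℕ n (minorℕ G (suc j)))
                        +ℤ sign (suc j) * (h * detℕ n (minorℕ H (suc j))))
         (colG 0 j) (colH 0 j) ⟩
      term G (suc j) +ℤ term H (suc j)
    ∎
    where
    distrib : ∀ s a x y → s * (a * (x +ℤ y)) ≡ s * (a * x) +ℤ s * (a * y)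
    distrib = solve-∀

Bool→ℕ : Bool → ℕ
Bool→ℕ true  = 1
Bool→ℕ false = 0

count : ℕ → (ℕ → Bool) → ℕ
count zero    P = 0
count (suc n) P = Bool→ℕ (P 0) + count n (λ i → P (suc i))

count-punchIn : ∀ j n (P : ℕ → Bool) → j ≤ n →
  count (suc n) P ≡ Bool→ℕ (P j) + count n (λ s → P (punchInℕ j s))
count-punchIn zero    n       P _         = refl
count-punchIn (suc j) (suc n) P (s≤s j≤n) =
  trans (cong (λ t → Bool→ℕ (P 0) + t) (count-punchIn j n (λ t → P (suc t)) j≤n))
        (ℕ+.x∙yz≈y∙xz (Bool→ℕ (P 0)) (Bool→ℕ (P (suc j))) _)

-- Every term of the expansion along row 0 vanishes: either row 0 lies in R and the entry is outside C,
-- or the minor inherits the hypothesis with the inequality between the counts preserved.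
detℕ-zero-if-rows-in-fewer-columns : ∀ n (M : Matℕ) (R C : ℕ → Bool) →
  (∀ i s → R i ≡ true → C s ≡ false → M i s ≡ + 0) → count n C < count n R → detℕ n M ≡ + 0
detℕ-zero-if-rows-in-fewer-columns zero    M R C outside ()
detℕ-zero-if-rows-in-fewer-columns (suc n) M R C outside C<R = ∑ℕ-zero (suc n) term
  where
  term : ∀ j → j < suc n → sign j * (M 0 j * detℕ n (minorℕ M j)) ≡ + 0
  term j (s≤s j≤n) = by-cases (R 0) (C j) refl refl
    where
    C′ R′ : ℕ → Bool
    C′ s = C (punchInℕ j s)
    R′ i = R (suc i)
    counts : ∀ {r c} → R 0 ≡ r → C j ≡ c → Bool→ℕ c + count n C′ < Bool→ℕ r + count n R′
    counts refl refl = subst (_< count (suc n) R) (count-punchIn j n C j≤n) C<R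
    minor≡0 : count n C′ < count n R′ → detℕ n (minorℕ M j) ≡ + 0
    minor≡0 = detℕ-zero-if-rows-in-fewer-columns n (minorℕ M j) R′ C′ (λ i s → outside (suc i) (punchInℕ j s))
    by-cases : ∀ r c → R 0 ≡ r → C j ≡ c → sign j * (M 0 j * detℕ n (minorℕ M j)) ≡ + 0
    by-cases true  false r₀ cⱼ = term≡0-entry (sign j) (detℕ n (minorℕ M j)) (outside 0 j r₀ cⱼ)
    by-cases true  true  r₀ cⱼ =
      term≡0-minor (sign j) (M 0 j) (minor≡0 (ℕₚ.+-cancelˡ-< 1 _ _ (counts r₀ cⱼ)))
    by-cases false c     r₀ cⱼ =
      term≡0-minor (sign j) (M 0 j) (minor≡0 (ℕₚ.≤-<-trans (ℕₚ.m≤n+m _ (Bool→ℕ c)) (counts r₀ cⱼ)))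

-- inRange a L i holds iff a ≤ i < a + L.
inRange : ℕ → ℕ → ℕ → Bool
inRange zero    zero    i       = false
inRange zero    (suc L) zero    = true
inRange zero    (suc L) (suc i) = inRange zero L i
inRange (suc a) L       zero    = false
inRange (suc a) L       (suc i) = inRange a L i

inRange-punchIn : ∀ a L s → inRange a (suc L) (punchInℕ a s) ≡ inRange a L s
inRange-punchIn zero    L s       = refl
inRange-punchIn (suc a) L zero    = refl
inRange-punchIn (suc a) L (suc s) = inRange-punchIn a L s

count-inRange-≤ : ∀ n a L → count n (inRange a L) ≤ L
count-inRange-≤ zero    a       L       = z≤n
count-inRange-≤ (suc n) zero    zero    = count-inRange-≤ n zero zero
count-inRange-≤ (suc n) zero    (suc L) = s≤s (count-inRange-≤ n zero L)
count-inRange-≤ (suc n) (suc a) L       = count-inRange-≤ n a L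

count-inRange : ∀ n a L → a + L ≤ n → count n (inRange a L) ≡ L
count-inRange zero    zero    zero    _         = refl
count-inRange (suc n) zero    zero    _         = count-inRange n zero zero z≤n
count-inRange (suc n) zero    (suc L) (s≤s a+L≤n) = cong suc (count-inRange n zero L a+L≤n)
count-inRange (suc n) (suc a) L       (s≤s a+L≤n) = count-inRange n a L a+L≤n

inRange-+ : ∀ k a L u → inRange (k + a) L (k + u) ≡ inRange a L u
inRange-+ zero    a L u = refl
inRange-+ (suc k) a L u = inRange-+ k a L u

inRange-+⁻¹ : ∀ k a L i → inRange (k + a) L i ≡ true → ∃[ u ] i ≡ k + u × inRange a L u ≡ true
inRange-+⁻¹ zero    a L i       i∈ = i , refl , i∈
inRange-+⁻¹ (suc k) a L (suc i) i∈ with inRange-+⁻¹ k a L i i∈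
... | u , refl , u∈ = u , refl , u∈

<-or-offset : ∀ k t → t < k ⊎ ∃[ u ] t ≡ k + u
<-or-offset zero    t       = inj₂ (t , refl)
<-or-offset (suc k) zero    = inj₁ (s≤s z≤n)
<-or-offset (suc k) (suc t) with <-or-offset k t
... | inj₁ t<k       = inj₁ (s≤s t<k)
... | inj₂ (u , refl) = inj₂ (u , refl)

-- Paths and block-diagonal matrices

pathPoly : ℤ → ℕ → ℤ
pathPoly x zero          = + 1
pathPoly x (suc zero)    = x
pathPoly x (suc (suc n)) = x * pathPoly x (suc n) - pathPoly x n

detℕ-pendant : ∀ n (M : Matℕ) x → M 0 0 ≡ x → M 0 1 ≡ -1ℤ → M 1 0 ≡ -1ℤ →
  (∀ j → M 0 (suc (suc j)) ≡ + 0) → (∀ i → M (suc (suc i)) 0 ≡ + 0) →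
  detℕ (suc (suc n)) M
    ≡ x * detℕ (suc n) (λ i s → M (suc i) (suc s)) - detℕ n (λ i s → M (suc (suc i)) (suc (suc s)))
detℕ-pendant n M x m₀₀ m₀₁ m₁₀ row₀ col₀ =
  trans (cong₂ (λ a b → + 1 * (a * A) +ℤ b) m₀₀
          (cong₂ _+ℤ_
            (cong₂ (λ a b → -1ℤ * (a * b)) m₀₁ (trans minor₁ (cong (λ a → + 1 * (a * C)) m₁₀)))
                      (∑ℕ-zero n λ j _ → term≡0-entry (sign (suc (suc j))) _ (row₀ j))))
        (simplify x A C)
  where
  A = detℕ (suc n) (λ i s → M (suc i) (suc s))
  C = detℕ n (λ i s → M (suc (suc i)) (suc (suc s)))
  minor₁ : detℕ (suc n) (minorℕ M 1) ≡ + 1 * (M 1 0 * C)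
  minor₁ = detℕ-column₀-single 0 n (minorℕ M 1) (s≤s z≤n) λ where
    zero    0≢0 → ⊥-elim (0≢0 refl)
    (suc i) _   → col₀ i
  simplify : ∀ x A C → + 1 * (x * A) +ℤ (-1ℤ * (-1ℤ * (+ 1 * (-1ℤ * C))) +ℤ + 0) ≡ x * A - C
  simplify = solve-∀

pathLink : ℕ → ℕ → ℤ
pathLink zero    j       = + 0
pathLink (suc c) zero    = -1ℤ
pathLink (suc c) (suc j) = + 0

-- pathBlock x c G is the block-diagonal matrix (x I − A(P_c)) ⊕ G.
pathBlock : ℤ → ℕ → Matℕ → Matℕ
pathBlock x zero    G i       j       = G i j
pathBlock x (suc c) G zero    zero    = x
pathBlock x (suc c) G zero    (suc j) = pathLink c j
pathBlock x (suc c) G (suc i) zero    = pathLink c i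
pathBlock x (suc c) G (suc i) (suc j) = pathBlock x c G i j

detℕ-pathBlock : ∀ x c n (G : Matℕ) → detℕ (c + n) (pathBlock x c G) ≡ pathPoly x c * detℕ n G
detℕ-pathBlock x zero n G = sym (ℤₚ.*-identityˡ (detℕ n G))
detℕ-pathBlock x (suc zero) n G =
  trans (detℕ-column₀-single 0 n (pathBlock x 1 G) (s≤s z≤n) λ where
           zero    0≢0 → ⊥-elim (0≢0 refl)
           (suc i) _   → refl)
        (ℤₚ.*-identityˡ (x * detℕ n G))
detℕ-pathBlock x (suc (suc c)) n G =
  trans (detℕ-pendant (c + n) (pathBlock x (suc (suc c)) G) x refl refl refl (λ _ → refl) (λ _ → refl))
   (trans (cong₂ (λ a b → x * a - b) (detℕ-pathBlock x (suc c) n G) (detℕ-pathBlock x c n G))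
     (factor x (pathPoly x (suc c)) (pathPoly x c) (detℕ n G)))
  where
  factor : ∀ x p q d → x * (p * d) - q * d ≡ (x * p - q) * d
  factor = solve-∀

pathBlock-cong : ∀ x c {G H : Matℕ} → (∀ i j → G i j ≡ H i j) →
  ∀ i j → pathBlock x c G i j ≡ pathBlock x c H i j
pathBlock-cong x zero    eq i       j       = eq i j
pathBlock-cong x (suc c) eq zero    zero    = refl
pathBlock-cong x (suc c) eq zero    (suc j) = refl
pathBlock-cong x (suc c) eq (suc i) zero    = refl
pathBlock-cong x (suc c) eq (suc i) (suc j) = pathBlock-cong x c eq i j

pathBlock-+ : ∀ x k (G : Matℕ) i u → pathBlock x k G (k + i) (k + u) ≡ G i u
pathBlock-+ x zero    G i u = refl
pathBlock-+ x (suc k) G i u = pathBlock-+ x k G i u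

pathLink-+ : ∀ k i → pathLink k (k + i) ≡ + 0
pathLink-+ zero    i = refl
pathLink-+ (suc k) i = refl

pathBlock-below : ∀ x k (G : Matℕ) i t → t < k → pathBlock x k G (k + i) t ≡ + 0
pathBlock-below x (suc k) G i zero    _         = pathLink-+ k i
pathBlock-below x (suc k) G i (suc t) (s≤s t<k) = pathBlock-below x k G i t t<k

pathBlock-outside : ∀ x c (G : Matℕ) i t → inRange 0 c i ≡ true → inRange 0 c t ≡ false →
  pathBlock x c G i t ≡ + 0
pathBlock-outside x (suc zero)    G zero    (suc t)       _ _ = refl
pathBlock-outside x (suc (suc c)) G zero    (suc (suc t)) _ _ = refl
pathBlock-outside x (suc c)       G (suc i) (suc t)       i∈ t∉ = pathBlock-outside x c G i t i∈ t∉

principalMinor : ℕ → Matℕ → Matℕ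
principalMinor t M i s = M (punchInℕ t i) (punchInℕ t s)

pathLink-punchIn : ∀ c t s → pathLink c (punchInℕ (c + t) s) ≡ pathLink c s
pathLink-punchIn zero    t s       = refl
pathLink-punchIn (suc c) t zero    = refl
pathLink-punchIn (suc c) t (suc s) = refl

principalMinor-pathBlock : ∀ x c t (G : Matℕ) i s →
  principalMinor (c + t) (pathBlock x c G) i s ≡ pathBlock x c (principalMinor t G) i s
principalMinor-pathBlock x zero    t G i       s       = refl
principalMinor-pathBlock x (suc c) t G zero    zero    = refl
principalMinor-pathBlock x (suc c) t G zero    (suc s) = pathLink-punchIn c t s
principalMinor-pathBlock x (suc c) t G (suc i) zero    = pathLink-punchIn c t i
principalMinor-pathBlock x (suc c) t G (suc i) (suc s) = principalMinor-pathBlock x c t G i s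

-- The matrix of a starlike tree

padZeros : ℕ → (ℕ → ℤ) → ℕ → ℤ
padZeros zero    w j       = w j
padZeros (suc c) w zero    = + 0
padZeros (suc c) w (suc j) = padZeros c w j

prependBranch : ℕ → (ℕ → ℤ) → ℕ → ℤ
prependBranch zero    w j       = w j
prependBranch (suc c) w zero    = -1ℤ
prependBranch (suc c) w (suc j) = padZeros c w j

-- Row 0 of x I − A(S(cs)) without its diagonal entry: −1 at the first vertex of every branch.
centerRow : List ℕ → ℕ → ℤ
centerRow []       = λ _ → + 0
centerRow (c ∷ cs) = prependBranch c (centerRow cs)

δℕ : ℕ → ℕ → ℤ
δℕ zero    zero    = + 1
δℕ zero    (suc j) = + 0
δℕ (suc i) zero    = + 0
δℕ (suc i) (suc j) = δℕ i j

Bool→ℤ : Bool → ℤ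
Bool→ℤ b = if b then + 1 else + 0

charMatrix : ℤ → (ℕ → ℕ → Bool) → Matℕ
charMatrix x B i j = x * δℕ i j - Bool→ℤ (B i j)

branchMatrix : ℤ → List ℕ → Matℕ
branchMatrix x []       = charMatrix x (λ _ _ → false)
branchMatrix x (c ∷ cs) = pathBlock x c (branchMatrix x cs)

starMatrix : ℤ → List ℕ → Matℕ
starMatrix x cs zero    zero    = x
starMatrix x cs zero    (suc j) = centerRow cs j
starMatrix x cs (suc i) zero    = centerRow cs i
starMatrix x cs (suc i) (suc j) = branchMatrix x cs i j

branchProduct : ℤ → List ℕ → ℤ
branchProduct x []       = + 1
branchProduct x (c ∷ cs) = pathPoly x c * branchProduct x cs

-- pathPolyPred x c = 𝐏_{c−1}, and 0 for c = 0, where there is no first vertex to delete.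
pathPolyPred : ℤ → ℕ → ℤ
pathPolyPred x zero    = + 0
pathPolyPred x (suc c) = pathPoly x c

-- branchCofactorSum x (c₁ ∷ … ∷ c_r) = ∑ᵢ 𝐏_{cᵢ−1} ∏_{k≠i} 𝐏_{c_k}.
branchCofactorSum : ℤ → List ℕ → ℤ
branchCofactorSum x []       = + 0
branchCofactorSum x (c ∷ cs) = pathPolyPred x c * branchProduct x cs +ℤ pathPoly x c * branchCofactorSum x cs

detℕ-branchMatrix : ∀ x cs → detℕ (sum cs) (branchMatrix x cs) ≡ branchProduct x cs
detℕ-branchMatrix x []       = refl
detℕ-branchMatrix x (c ∷ cs) =
  trans (detℕ-pathBlock x c (sum cs) (branchMatrix x cs)) (cong (pathPoly x c *_) (detℕ-branchMatrix x cs))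

padZeros-inRange : ∀ L w i → inRange 0 L i ≡ true → padZeros L w i ≡ + 0
padZeros-inRange (suc L) w zero    _  = refl
padZeros-inRange (suc L) w (suc i) i∈ = padZeros-inRange L w i i∈

padZeros-< : ∀ c w j → j < c → padZeros c w j ≡ + 0
padZeros-< (suc c) w zero    _         = refl
padZeros-< (suc c) w (suc j) (s≤s j<c) = padZeros-< c w j j<c

padZeros-+ : ∀ c w u → padZeros c w (c + u) ≡ w u
padZeros-+ zero    w u = refl
padZeros-+ (suc c) w u = padZeros-+ c w u

-- j is the first vertex of a branch, which occupies the indices j, …, j + len.
record BranchHead (x : ℤ) (cs : List ℕ) (j : ℕ) : Set where
  field
    len      : ℕ
    fits     : j + suc len ≤ sum cs
    head     : centerRow cs j ≡ -1ℤ
    rest     : ∀ i → inRange j (suc len) i ≡ true → i ≢ j → centerRow cs i ≡ + 0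
    isolated : ∀ i t → inRange j (suc len) i ≡ true → inRange j (suc len) t ≡ false →
               branchMatrix x cs i t ≡ + 0

centerRow-view : ∀ x cs j → centerRow cs j ≡ + 0 ⊎ BranchHead x cs j
centerRow-view x []           j = inj₁ refl
centerRow-view x (zero ∷ cs)  j with centerRow-view x cs j
... | inj₁ eq = inj₁ eq
... | inj₂ H  = inj₂ record { BranchHead H }
centerRow-view x (suc c ∷ cs) zero = inj₂ record
  { len      = c
  ; fits     = ℕₚ.m≤m+n (suc c) (sum cs)
  ; head     = refl
  ; rest     = λ where
      zero    _ 0≢0 → ⊥-elim (0≢0 refl)
      (suc i) i∈ _  → padZeros-inRange c (centerRow cs) i i∈
  ; isolated = pathBlock-outside x (suc c) (branchMatrix x cs)
  }
centerRow-view x (suc c ∷ cs) (suc j) with <-or-offset c j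
... | inj₁ j<c = inj₁ (padZeros-< c (centerRow cs) j j<c)
... | inj₂ (u , refl) with centerRow-view x cs u
...   | inj₁ eq = inj₁ (trans (padZeros-+ c (centerRow cs) u) eq)
...   | inj₂ H  = inj₂ record
  { len      = len
  ; fits     = subst (_≤ suc c + sum cs) (sym (ℕₚ.+-assoc (suc c) u (suc len))) (ℕₚ.+-monoʳ-≤ (suc c) fits)
  ; head     = trans (padZeros-+ c (centerRow cs) u) head
  ; rest     = rest′
  ; isolated = isolated′
  }
  where
  open BranchHead H
  rest′ : ∀ i → inRange (suc c + u) (suc len) i ≡ true → i ≢ suc (c + u) → centerRow (suc c ∷ cs) i ≡ + 0
  rest′ i i∈ i≢ with inRange-+⁻¹ (suc c) u (suc len) i i∈
  ... | i′ , refl , i′∈ =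
    trans (padZeros-+ c (centerRow cs) i′) (rest i′ i′∈ (λ eq → i≢ (cong (λ v → suc c + v) eq)))
  isolated′ : ∀ i t → inRange (suc c + u) (suc len) i ≡ true → inRange (suc c + u) (suc len) t ≡ false →
    branchMatrix x (suc c ∷ cs) i t ≡ + 0
  isolated′ i t i∈ t∉ with inRange-+⁻¹ (suc c) u (suc len) i i∈ | <-or-offset (suc c) t
  ... | i′ , refl , i′∈ | inj₁ t<c        = pathBlock-below x (suc c) (branchMatrix x cs) i′ t t<c
  ... | i′ , refl , i′∈ | inj₂ (t′ , refl) =
    trans (pathBlock-+ x (suc c) (branchMatrix x cs) i′ t′)
          (isolated i′ t′ i′∈ (trans (sym (inRange-+ (suc c) u (suc len) t′)) t∉))

negUnit : ℕ → ℕ → ℤ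
negUnit zero    zero    = -1ℤ
negUnit zero    (suc i) = + 0
negUnit (suc j) zero    = + 0
negUnit (suc j) (suc i) = negUnit j i

negUnit-self : ∀ j → negUnit j j ≡ -1ℤ
negUnit-self zero    = refl
negUnit-self (suc j) = negUnit-self j

negUnit-≢ : ∀ j i → i ≢ j → negUnit j i ≡ + 0
negUnit-≢ zero    zero    i≢j = ⊥-elim (i≢j refl)
negUnit-≢ zero    (suc i) _   = refl
negUnit-≢ (suc j) zero    _   = refl
negUnit-≢ (suc j) (suc i) i≢j = negUnit-≢ j i (λ eq → i≢j (cong suc eq))

replaceColumn₀ : (ℕ → ℤ) → Matℕ → Matℕ
replaceColumn₀ v M i zero    = v i
replaceColumn₀ v M i (suc s) = M i (suc s)

-- Write the first column of the minor as −e_j plus a remainder. The −e_j part is expanded along that column;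
-- in the remainder the len + 1 rows of j's branch are supported on the len other columns of that branch.
detℕ-starMinor : ∀ x cs j N → BranchHead x cs j → sum cs ≡ suc N → j < suc N →
  detℕ (suc N) (minorℕ (starMatrix x cs) (suc j)) ≡ sign j * (-1ℤ * detℕ N (principalMinor j (branchMatrix x cs)))
detℕ-starMinor x cs j N H sum≡ j<n =
  begin
    detℕ (suc N) M
  ≡⟨ detℕ-column₀-additive {suc N} M U W (s≤s z≤n) (λ i → split (centerRow cs i) (negUnit j i))
       (λ _ _ → refl) (λ _ _ → refl) ⟩
    detℕ (suc N) U +ℤ detℕ (suc N) W
  ≡⟨ cong₂ _+ℤ_ (detℕ-column₀-single j N U j<n (negUnit-≢ j)) W≡0 ⟩
    sign j * (negUnit j j * D) +ℤ + 0
  ≡⟨ ℤₚ.+-identityʳ _ ⟩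
    sign j * (negUnit j j * D)
  ≡⟨ cong (λ a → sign j * (a * D)) (negUnit-self j) ⟩
    sign j * (-1ℤ * D)
  ∎
  where
  open ≡-Reasoning
  open BranchHead H
  M U W : Matℕ
  M = minorℕ (starMatrix x cs) (suc j)
  U = replaceColumn₀ (negUnit j) M
  W = replaceColumn₀ (λ i → centerRow cs i - negUnit j i) M
  D = detℕ N (principalMinor j (branchMatrix x cs))
  split : ∀ v a → v ≡ a +ℤ (v - a)
  split = solve-∀
  W-outside : ∀ i s → inRange j (suc len) i ≡ true → inRange (suc j) len s ≡ false → W i s ≡ + 0
  W-outside i zero i∈ _ with i ≟ j
  ... | yes refl = cong₂ _-_ head (negUnit-self j)
  ... | no  i≢j  = cong₂ _-_ (rest i i∈ i≢j) (negUnit-≢ j i i≢j)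
  W-outside i (suc s) i∈ s∉ = isolated i (punchInℕ j s) i∈ (trans (inRange-punchIn j len s) s∉)
  W≡0 : detℕ (suc N) W ≡ + 0
  W≡0 = detℕ-zero-if-rows-in-fewer-columns (suc N) W (inRange j (suc len)) (inRange (suc j) len) W-outside
    (subst (count (suc N) (inRange (suc j) len) <_)
      (sym (count-inRange (suc N) j (suc len) (subst (j + suc len ≤_) sum≡ fits)))
      (s≤s (count-inRange-≤ N j len)))

centerTerm : ∀ x cs n → sum cs ≡ n → ∀ j → j < n →
  sign (suc j) * (centerRow cs j * detℕ n (minorℕ (starMatrix x cs) (suc j)))
    ≡ centerRow cs j * detℕ (pred n) (principalMinor j (branchMatrix x cs))
centerTerm x cs (suc N) sum≡ j j<n with centerRow-view x cs j
... | inj₁ v≡0 =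
  trans (term≡0-entry (sign (suc j)) _ v≡0) (sym (product≡0ˡ (detℕ N (principalMinor j (branchMatrix x cs))) v≡0))
... | inj₂ H =
  begin
    sign (suc j) * (centerRow cs j * detℕ (suc N) (minorℕ (starMatrix x cs) (suc j)))
  ≡⟨ cong₂ (λ s d → s * (centerRow cs j * d)) (sign-suc j) (detℕ-starMinor x cs j N H sum≡ j<n) ⟩
    - sign j * (centerRow cs j * (sign j * (-1ℤ * D)))
  ≡⟨ cong (λ v → - sign j * (v * (sign j * (-1ℤ * D)))) (BranchHead.head H) ⟩
    - sign j * (-1ℤ * (sign j * (-1ℤ * D)))
  ≡⟨ regroup (sign j) D ⟩
    -1ℤ * ((sign j * sign j) * D)
  ≡⟨ cong (λ s → -1ℤ * (s * D)) (sign*sign j) ⟩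
    -1ℤ * (+ 1 * D)
  ≡⟨ cong₂ _*_ (sym (BranchHead.head H)) (ℤₚ.*-identityˡ D) ⟩
    centerRow cs j * D
  ∎
  where
  open ≡-Reasoning
  D = detℕ N (principalMinor j (branchMatrix x cs))
  regroup : ∀ s D → - s * (-1ℤ * (s * (-1ℤ * D))) ≡ -1ℤ * ((s * s) * D)
  regroup = solve-∀

centerCofactor : ℤ → List ℕ → ℕ → ℤ
centerCofactor x cs j = centerRow cs j * detℕ (pred (sum cs)) (principalMinor j (branchMatrix x cs))

centerCofactor-shift : ∀ x c T (G : Matℕ) w t → t < T →
  padZeros c w (c + t) * detℕ (pred (suc c + T)) (principalMinor (suc c + t) (pathBlock x (suc c) G))
    ≡ pathPoly x (suc c) * (w t * detℕ (pred T) (principalMinor t G))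
centerCofactor-shift x c (suc T) G w t _ =
  trans (cong₂ _*_ (padZeros-+ c w t)
          (trans (cong (λ m → detℕ m (principalMinor (suc c + t) (pathBlock x (suc c) G))) (ℕₚ.+-suc c T))
            (trans (detℕ-cong (suc c + T) (principalMinor-pathBlock x (suc c) t G))
              (detℕ-pathBlock x (suc c) T (principalMinor t G)))))
        (ℤ*.x∙yz≈y∙xz (w t) (pathPoly x (suc c)) _)

centerSum : ∀ x cs → ∑ℕ (sum cs) (centerCofactor x cs) ≡ - branchCofactorSum x cs
centerSum x [] = refl
centerSum x (zero ∷ cs) = trans (centerSum x cs) (cong -_ (simplify (branchProduct x cs) (branchCofactorSum x cs)))
  where
  simplify : ∀ p s → s ≡ + 0 * p +ℤ + 1 * s
  simplify = solve-∀
centerSum x (suc c ∷ cs) =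
  begin
    ∑ℕ (suc c + T) f
  ≡⟨ ∑ℕ-split (suc c) T f ⟩
    (f 0 +ℤ ∑ℕ c (λ j → f (suc j))) +ℤ ∑ℕ T (λ t → f (suc c + t))
  ≡⟨ cong₂ (λ a b → (-1ℤ * a +ℤ b) +ℤ ∑ℕ T (λ t → f (suc c + t)))
       first-block (∑ℕ-zero c rest-of-first-block) ⟩
    (-1ℤ * (pathPoly x c * branchProduct x cs) +ℤ + 0) +ℤ ∑ℕ T (λ t → f (suc c + t))
  ≡⟨ cong ((-1ℤ * (pathPoly x c * branchProduct x cs) +ℤ + 0) +ℤ_) other-blocks ⟩
    (-1ℤ * (pathPoly x c * branchProduct x cs) +ℤ + 0) +ℤ pathPoly x (suc c) * (- branchCofactorSum x cs)
  ≡⟨ collect (pathPoly x c) (branchProduct x cs) (pathPoly x (suc c)) (branchCofactorSum x cs) ⟩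
    - branchCofactorSum x (suc c ∷ cs)
  ∎
  where
  open ≡-Reasoning
  T = sum cs
  f : ℕ → ℤ
  f = centerCofactor x (suc c ∷ cs)
  first-block : detℕ (c + T) (pathBlock x c (branchMatrix x cs)) ≡ pathPoly x c * branchProduct x cs
  first-block = trans (detℕ-pathBlock x c T (branchMatrix x cs)) (cong (pathPoly x c *_) (detℕ-branchMatrix x cs))
  rest-of-first-block : ∀ j → j < c → f (suc j) ≡ + 0
  rest-of-first-block j j<c = product≡0ˡ _ (padZeros-< c (centerRow cs) j j<c)
  other-blocks : ∑ℕ T (λ t → f (suc c + t)) ≡ pathPoly x (suc c) * (- branchCofactorSum x cs)
  other-blocks =
    trans (∑ℕ-cong T (centerCofactor-shift x c T (branchMatrix x cs) (centerRow cs)))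
      (trans (∑ℕ-*ˡ T (pathPoly x (suc c)) (centerCofactor x cs)) (cong (pathPoly x (suc c) *_) (centerSum x cs)))
  collect : ∀ a p b s → (-1ℤ * (a * p) +ℤ + 0) +ℤ b * (- s) ≡ - (a * p +ℤ b * s)
  collect = solve-∀

detℕ-starMatrix : ∀ x cs → detℕ (suc (sum cs)) (starMatrix x cs) ≡ x * branchProduct x cs - branchCofactorSum x cs
detℕ-starMatrix x cs =
  trans (cong₂ (λ a b → + 1 * (x * a) +ℤ b) (detℕ-branchMatrix x cs)
          (trans (∑ℕ-cong (sum cs) (centerTerm x cs (sum cs) refl)) (centerSum x cs)))
        (finish x (branchProduct x cs) (branchCofactorSum x cs))
  where
  finish : ∀ x p s → + 1 * (x * p) +ℤ - s ≡ x * p - s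
  finish = solve-∀

-- From edge lists to matrices

shiftEdges : List (ℕ × ℕ) → List (ℕ × ℕ)
shiftEdges = List.map (Product.map suc suc)

pathEdgesFrom-suc : ∀ p s c → pathEdgesFrom (suc p) (suc s) c ≡ shiftEdges (pathEdgesFrom p s c)
pathEdgesFrom-suc p s zero    = refl
pathEdgesFrom-suc p s (suc c) = cong ((suc p , suc s) ∷_) (pathEdgesFrom-suc s (suc s) c)

joins : ℕ × ℕ → ℕ → ℕ → Bool
joins (p , q) i j = ((p ≡ᵇ i) ∧ (q ≡ᵇ j)) ∨ ((p ≡ᵇ j) ∧ (q ≡ᵇ i))

isEdge-++ : ∀ es fs i j → isEdge (es ++ fs) i j ≡ isEdge es i j ∨ isEdge fs i j
isEdge-++ []             fs i j = refl
isEdge-++ ((p , q) ∷ es) fs i j =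
  trans (cong (joins (p , q) i j ∨_) (isEdge-++ es fs i j))
        (sym (Boolₚ.∨-assoc (joins (p , q) i j) (isEdge es i j) (isEdge fs i j)))

isEdge-shift : ∀ es i j → isEdge (shiftEdges es) (suc i) (suc j) ≡ isEdge es i j
isEdge-shift []             i j = refl
isEdge-shift ((p , q) ∷ es) i j = cong (joins (p , q) i j ∨_) (isEdge-shift es i j)

isEdge-sym : ∀ es i j → isEdge es i j ≡ isEdge es j i
isEdge-sym []             i j = refl
isEdge-sym ((p , q) ∷ es) i j =
  cong₂ _∨_ (Boolₚ.∨-comm ((p ≡ᵇ i) ∧ (q ≡ᵇ j)) ((p ≡ᵇ j) ∧ (q ≡ᵇ i))) (isEdge-sym es i j)

isEdge-shift-0ˡ : ∀ es j → isEdge (shiftEdges es) 0 j ≡ false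
isEdge-shift-0ˡ []             j = refl
isEdge-shift-0ˡ ((p , q) ∷ es) j rewrite Boolₚ.∧-zeroʳ (suc p ≡ᵇ j) = isEdge-shift-0ˡ es j

isEdge-shift-0ʳ : ∀ es i → isEdge (shiftEdges es) i 0 ≡ false
isEdge-shift-0ʳ es i = trans (isEdge-sym (shiftEdges es) i 0) (isEdge-shift-0ˡ es i)

-- Paths with c₁, c₂, … vertices, placed consecutively from vertex s.
branchEdges : ℕ → List ℕ → List (ℕ × ℕ)
branchEdges s []       = []
branchEdges s (c ∷ cs) = pathEdgesFrom s (suc s) (c ∸ 1) ++ branchEdges (s + c) cs

branchEdges-suc : ∀ s cs → branchEdges (suc s) cs ≡ shiftEdges (branchEdges s cs)
branchEdges-suc s []       = refl
branchEdges-suc s (c ∷ cs) =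
  trans (cong₂ _++_ (pathEdgesFrom-suc s (suc s) (c ∸ 1)) (branchEdges-suc (s + c) cs))
        (sym (List.map-++ (Product.map suc suc) (pathEdgesFrom s (suc s) (c ∸ 1)) (branchEdges (s + c) cs)))

firstEdge : ℕ → List (ℕ × ℕ)
firstEdge zero    = []
firstEdge (suc c) = (0 , 1) ∷ []

branchEdges-grow : ∀ c cs → branchEdges 0 (suc c ∷ cs) ≡ firstEdge c ++ shiftEdges (branchEdges 0 (c ∷ cs))
branchEdges-grow zero    cs = branchEdges-suc 0 cs
branchEdges-grow (suc c) cs = cong ((0 , 1) ∷_)
  (trans (cong₂ _++_ (pathEdgesFrom-suc 0 1 c) (branchEdges-suc (suc c) cs))
         (sym (List.map-++ (Product.map suc suc) (pathEdgesFrom 0 1 c) (branchEdges (suc c) cs))))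

pathLinkᵇ : ℕ → ℕ → Bool
pathLinkᵇ zero    j       = false
pathLinkᵇ (suc c) zero    = true
pathLinkᵇ (suc c) (suc j) = false

pathBlockᵇ : ℕ → (ℕ → ℕ → Bool) → ℕ → ℕ → Bool
pathBlockᵇ zero    B i       j       = B i j
pathBlockᵇ (suc c) B zero    zero    = false
pathBlockᵇ (suc c) B zero    (suc j) = pathLinkᵇ c j
pathBlockᵇ (suc c) B (suc i) zero    = pathLinkᵇ c i
pathBlockᵇ (suc c) B (suc i) (suc j) = pathBlockᵇ c B i j

isEdge-branchEdges : ∀ c cs i j →
  isEdge (branchEdges 0 (c ∷ cs)) i j ≡ pathBlockᵇ c (isEdge (branchEdges 0 cs)) i j
isEdge-branchEdges zero    cs i j = refl
isEdge-branchEdges (suc c) cs i j =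
  trans (cong (λ es → isEdge es i j) (branchEdges-grow c cs))
   (trans (isEdge-++ (firstEdge c) (shiftEdges (branchEdges 0 (c ∷ cs))) i j) (by-cases c i j))
  where
  by-cases : ∀ c i j → isEdge (firstEdge c) i j ∨ isEdge (shiftEdges (branchEdges 0 (c ∷ cs))) i j
                       ≡ pathBlockᵇ (suc c) (isEdge (branchEdges 0 cs)) i j
  by-cases zero    zero          zero          = isEdge-shift-0ˡ (branchEdges 0 (0 ∷ cs)) 0
  by-cases zero    zero          (suc j)       = isEdge-shift-0ˡ (branchEdges 0 (0 ∷ cs)) (suc j)
  by-cases zero    (suc i)       zero          = isEdge-shift-0ʳ (branchEdges 0 (0 ∷ cs)) (suc i)
  by-cases (suc c) zero          zero          = isEdge-shift-0ˡ (branchEdges 0 (suc c ∷ cs)) 0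
  by-cases (suc c) zero          (suc zero)    = refl
  by-cases (suc c) zero          (suc (suc j)) = isEdge-shift-0ˡ (branchEdges 0 (suc c ∷ cs)) (suc (suc j))
  by-cases (suc c) (suc zero)    zero          = refl
  by-cases (suc c) (suc (suc i)) zero          = isEdge-shift-0ʳ (branchEdges 0 (suc c ∷ cs)) (suc (suc i))
  by-cases zero    (suc i)       (suc j)       =
    trans (isEdge-shift (branchEdges 0 (zero ∷ cs)) i j) (isEdge-branchEdges zero cs i j)
  by-cases (suc c) (suc i)       (suc j)       =
    trans (isEdge-shift (branchEdges 0 (suc c ∷ cs)) i j) (isEdge-branchEdges (suc c) cs i j)

x*1-0≡x : ∀ x → x * + 1 - + 0 ≡ x
x*1-0≡x x = trans (ℤₚ.+-identityʳ (x * + 1)) (ℤₚ.*-identityʳ x)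

x*0-b≡-b : ∀ x b → x * + 0 - b ≡ - b
x*0-b≡-b x b = trans (cong (_- b) (ℤₚ.*-zeroʳ x)) (ℤₚ.+-identityˡ (- b))

-‿pathLinkᵇ : ∀ c j → - Bool→ℤ (pathLinkᵇ c j) ≡ pathLink c j
-‿pathLinkᵇ zero    j       = refl
-‿pathLinkᵇ (suc c) zero    = refl
-‿pathLinkᵇ (suc c) (suc j) = refl

charMatrix-pathBlockᵇ : ∀ x c B i j → charMatrix x (pathBlockᵇ c B) i j ≡ pathBlock x c (charMatrix x B) i j
charMatrix-pathBlockᵇ x zero    B i       j       = refl
charMatrix-pathBlockᵇ x (suc c) B zero    zero    = x*1-0≡x x
charMatrix-pathBlockᵇ x (suc c) B zero    (suc j) = trans (x*0-b≡-b x _) (-‿pathLinkᵇ c j)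
charMatrix-pathBlockᵇ x (suc c) B (suc i) zero    = trans (x*0-b≡-b x _) (-‿pathLinkᵇ c i)
charMatrix-pathBlockᵇ x (suc c) B (suc i) (suc j) = charMatrix-pathBlockᵇ x c B i j

charMatrix-branchEdges : ∀ x cs i j → charMatrix x (isEdge (branchEdges 0 cs)) i j ≡ branchMatrix x cs i j
charMatrix-branchEdges x []       i j = refl
charMatrix-branchEdges x (c ∷ cs) i j =
  trans (cong (λ b → x * δℕ i j - Bool→ℤ b) (isEdge-branchEdges c cs i j))
   (trans (charMatrix-pathBlockᵇ x c (isEdge (branchEdges 0 cs)) i j)
     (pathBlock-cong x c (charMatrix-branchEdges x cs) i j))

isEdge-starEdges-branches : ∀ s cs i j → isEdge (starEdges (suc s) cs) (suc i) (suc j) ≡ isEdge (branchEdges s cs) i j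
isEdge-starEdges-branches s []       i j = refl
isEdge-starEdges-branches s (c ∷ cs) i j =
  trans (isEdge-++ (pathEdgesFrom 0 (suc s) c) (starEdges (suc s + c) cs) (suc i) (suc j))
   (trans (cong₂ _∨_ (spoke c) (isEdge-starEdges-branches (s + c) cs i j))
     (sym (isEdge-++ (pathEdgesFrom s (suc s) (c ∸ 1)) (branchEdges (s + c) cs) i j)))
  where
  spoke : ∀ c → isEdge (pathEdgesFrom 0 (suc s) c) (suc i) (suc j) ≡ isEdge (pathEdgesFrom s (suc s) (c ∸ 1)) i j
  spoke zero    = refl
  spoke (suc c) =
    trans (cong (λ es → isEdge es (suc i) (suc j)) (pathEdgesFrom-suc s (suc s) c))
          (isEdge-shift (pathEdgesFrom s (suc s) c) i j)

isEdge-starEdges-loop : ∀ s cs → isEdge (starEdges (suc s) cs) 0 0 ≡ false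
isEdge-starEdges-loop s []       = refl
isEdge-starEdges-loop s (c ∷ cs) =
  trans (isEdge-++ (pathEdgesFrom 0 (suc s) c) (starEdges (suc s + c) cs) 0 0)
    (cong₂ _∨_ (spoke c) (isEdge-starEdges-loop (s + c) cs))
  where
  spoke : ∀ c → isEdge (pathEdgesFrom 0 (suc s) c) 0 0 ≡ false
  spoke zero    = refl
  spoke (suc c) =
    trans (cong (λ es → isEdge es 0 0) (pathEdgesFrom-suc s (suc s) c)) (isEdge-shift-0ˡ (pathEdgesFrom s (suc s) c) 0)

padZeros-centerRow-[] : ∀ s j → padZeros s (centerRow []) j ≡ + 0
padZeros-centerRow-[] zero    j       = refl
padZeros-centerRow-[] (suc s) zero    = refl
padZeros-centerRow-[] (suc s) (suc j) = padZeros-centerRow-[] s j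

padZeros-prependBranch : ∀ c w s j R → - Bool→ℤ R ≡ padZeros (s + suc c) w j →
  - Bool→ℤ ((s ≡ᵇ j) ∨ R) ≡ padZeros s (prependBranch (suc c) w) j
padZeros-prependBranch c w zero    zero    R _  = refl
padZeros-prependBranch c w zero    (suc j) R eq = eq
padZeros-prependBranch c w (suc s) zero    R eq = eq
padZeros-prependBranch c w (suc s) (suc j) R eq = padZeros-prependBranch c w s j R eq

isEdge-starEdges-center : ∀ s cs j →
  - Bool→ℤ (isEdge (starEdges (suc s) cs) 0 (suc j)) ≡ padZeros s (centerRow cs) j
isEdge-starEdges-center s []          j = sym (padZeros-centerRow-[] s j)
isEdge-starEdges-center s (zero ∷ cs) j rewrite ℕₚ.+-identityʳ s = isEdge-starEdges-center s cs j
isEdge-starEdges-center s (suc c ∷ cs) j =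
  trans (cong (λ b → - Bool→ℤ b)
          (trans (isEdge-++ (pathEdgesFrom 0 (suc s) (suc c)) others 0 (suc j))
                 (cong (_∨ isEdge others 0 (suc j)) spoke)))
        (padZeros-prependBranch c (centerRow cs) s j (isEdge others 0 (suc j)) (isEdge-starEdges-center (s + suc c) cs j))
  where
  others = starEdges (suc s + suc c) cs
  spoke : isEdge (pathEdgesFrom 0 (suc s) (suc c)) 0 (suc j) ≡ (s ≡ᵇ j)
  spoke =
    trans (cong (λ es → ((s ≡ᵇ j) ∨ false) ∨ isEdge es 0 (suc j)) (pathEdgesFrom-suc s (suc s) c))
      (trans (cong (((s ≡ᵇ j) ∨ false) ∨_) (isEdge-shift-0ˡ (pathEdgesFrom s (suc s) c) (suc j)))
        (trans (Boolₚ.∨-identityʳ _) (Boolₚ.∨-identityʳ (s ≡ᵇ j))))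

charMatrix-starEdges : ∀ x cs i j → charMatrix x (isEdge (starEdges 1 cs)) i j ≡ starMatrix x cs i j
charMatrix-starEdges x cs zero zero =
  trans (cong (λ b → x * + 1 - Bool→ℤ b) (isEdge-starEdges-loop 0 cs)) (x*1-0≡x x)
charMatrix-starEdges x cs zero (suc j) =
  trans (x*0-b≡-b x _) (isEdge-starEdges-center 0 cs j)
charMatrix-starEdges x cs (suc i) zero =
  trans (cong (λ b → x * + 0 - Bool→ℤ b) (isEdge-sym (starEdges 1 cs) (suc i) 0))
   (trans (x*0-b≡-b x _) (isEdge-starEdges-center 0 cs i))
charMatrix-starEdges x cs (suc i) (suc j) =
  trans (cong (λ b → x * δℕ i j - Bool→ℤ b) (isEdge-starEdges-branches 0 cs i j)) (charMatrix-branchEdges x cs i j)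

δ≡δℕ : ∀ {n} (i j : Fin n) → δ i j ≡ δℕ (toℕ i) (toℕ j)
δ≡δℕ Fin.zero    Fin.zero    = refl
δ≡δℕ Fin.zero    (Fin.suc j) = refl
δ≡δℕ (Fin.suc i) Fin.zero    = refl
δ≡δℕ (Fin.suc i) (Fin.suc j) = δ≡δℕ i j

charPoly≡detℕ : ∀ G x → charPoly G x ≡ detℕ (order G) (charMatrix x (isEdge (edges G)))
charPoly≡detℕ G x =
  trans (det-cong (order G) (λ i j → cong (λ d → x * d - adj G i j) (δ≡δℕ i j)))
        (det≡detℕ (order G) (charMatrix x (isEdge (edges G))))

charPoly-starlike : ∀ x cs → charPoly (starlike cs) x ≡ x * branchProduct x cs - branchCofactorSum x cs
charPoly-starlike x cs =
  trans (charPoly≡detℕ (starlike cs) x)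
    (trans (detℕ-cong (suc (sum cs)) (charMatrix-starEdges x cs)) (detℕ-starMatrix x cs))

𝐏≡pathPoly : ∀ m x → 𝐏 m x ≡ pathPoly x m
𝐏≡pathPoly m x =
  begin
    𝐏 m x
  ≡⟨ charPoly≡detℕ (pathGraph m) x ⟩
    detℕ m (charMatrix x (isEdge (pathEdgesFrom 0 1 (m ∸ 1))))
  ≡⟨ detℕ-cong m (λ i j → cong (λ b → x * δℕ i j - Bool→ℤ b)
       (sym (trans (isEdge-++ (pathEdgesFrom 0 1 (m ∸ 1)) [] i j) (Boolₚ.∨-identityʳ _)))) ⟩
    detℕ m (charMatrix x (isEdge (branchEdges 0 (m ∷ []))))
  ≡⟨ detℕ-cong m (charMatrix-branchEdges x (m ∷ [])) ⟩
    detℕ m (branchMatrix x (m ∷ []))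
  ≡⟨ cong (λ k → detℕ k (branchMatrix x (m ∷ []))) (sym (ℕₚ.+-identityʳ m)) ⟩
    detℕ (m + 0) (branchMatrix x (m ∷ []))
  ≡⟨ detℕ-branchMatrix x (m ∷ []) ⟩
    pathPoly x m * + 1
  ≡⟨ ℤₚ.*-identityʳ (pathPoly x m) ⟩
    pathPoly x m
  ∎
  where open ≡-Reasoning

-- Algebra of path polynomials

pathPoly-suc : ∀ x n → pathPoly x (suc n) ≡ x * pathPoly x n - pathPolyPred x n
pathPoly-suc x zero    = sym (x*1-0≡x x)
pathPoly-suc x (suc n) = refl

pathPoly-+ : ∀ x a b → pathPoly x (a + b) ≡ pathPoly x a * pathPoly x b - pathPolyPred x a * pathPolyPred x b
pathPoly-+ x zero b = simplify (pathPoly x b) (pathPolyPred x b)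
  where
  simplify : ∀ p q → p ≡ + 1 * p - + 0 * q
  simplify = solve-∀
pathPoly-+ x (suc zero) b = trans (pathPoly-suc x b) (simplify x (pathPoly x b) (pathPolyPred x b))
  where
  simplify : ∀ x p q → x * p - q ≡ x * p - + 1 * q
  simplify = solve-∀
pathPoly-+ x (suc (suc a)) b =
  trans (cong₂ (λ u v → x * u - v) (pathPoly-+ x (suc a) b) (pathPoly-+ x a b))
        (regroup x (pathPoly x (suc a)) (pathPoly x a) (pathPolyPred x a) (pathPoly x b) (pathPolyPred x b)
                 (pathPoly-suc x a))
  where
  regroup : ∀ x P₁ P₀ Q₀ Pb Qb → P₁ ≡ x * P₀ - Q₀ →
    x * (P₁ * Pb - P₀ * Qb) - (P₀ * Pb - Q₀ * Qb) ≡ (x * P₁ - P₀) * Pb - P₁ * Qb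
  regroup x P₁ P₀ Q₀ Pb Qb refl = identity x P₀ Q₀ Pb Qb
    where
    identity : ∀ x P₀ Q₀ Pb Qb → x * ((x * P₀ - Q₀) * Pb - P₀ * Qb) - (P₀ * Pb - Q₀ * Qb)
                                  ≡ (x * (x * P₀ - Q₀) - P₀) * Pb - (x * P₀ - Q₀) * Qb
    identity = solve-∀

branchProduct-replicate : ∀ x m c → branchProduct x (replicate m c) ≡ pathPoly x c ^ m
branchProduct-replicate x zero    c = refl
branchProduct-replicate x (suc m) c = cong (pathPoly x c *_) (branchProduct-replicate x m c)

branchCofactorSum-replicate : ∀ x m c →
  branchCofactorSum x (replicate (suc m) c) ≡ + (suc m) * pathPolyPred x c * pathPoly x c ^ m
branchCofactorSum-replicate x zero c = simplify (pathPolyPred x c) (pathPoly x c)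
  where
  simplify : ∀ q p → q * + 1 +ℤ p * + 0 ≡ + 1 * q * + 1
  simplify = solve-∀
branchCofactorSum-replicate x (suc m) c =
  trans (cong₂ (λ a b → pathPolyPred x c * (pathPoly x c * a) +ℤ pathPoly x c * b)
               (branchProduct-replicate x m c) (branchCofactorSum-replicate x m c))
        (collect (pathPolyPred x c) (pathPoly x c) (pathPoly x c ^ m) (+ (suc m)))
  where
  collect : ∀ q p A M → q * (p * A) +ℤ p * (M * q * A) ≡ (+ 1 +ℤ M) * q * (p * A)
  collect = solve-∀

lemma3 : (q c d : ℕ) → 2 ≤ q → 1 ≤ c → 1 ≤ d → (x : ℤ) →
    charPoly (starlike (c ∷ replicate q d)) x
      ≡ (𝐏 d x ^ (q ∸ 1)) * (𝐏 (c + d + 1) x - (+ (q ∸ 1)) * 𝐏 c x * 𝐏 (d ∸ 1) x)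
lemma3 (suc (suc q)) (suc c) (suc d) (s≤s (s≤s z≤n)) (s≤s z≤n) (s≤s z≤n) x =
  begin
    charPoly (starlike (suc c ∷ ds)) x
  ≡⟨ charPoly-starlike x (suc c ∷ ds) ⟩
    x * (P (suc c) * branchProduct x ds) - (P c * branchProduct x ds +ℤ P (suc c) * branchCofactorSum x ds)
  ≡⟨ cong₂ (λ Π Σ → x * (P (suc c) * Π) - (P c * Π +ℤ P (suc c) * Σ))
       (branchProduct-replicate x (suc (suc q)) (suc d)) (branchCofactorSum-replicate x (suc q) (suc d)) ⟩
    x * (P (suc c) * (P (suc d) * A)) - (P c * (P (suc d) * A) +ℤ P (suc c) * (+ (suc (suc q)) * P d * A))
  ≡⟨ regroup x (P (suc c)) (P c) (P (suc d)) (P d) A (+ (suc q)) ⟩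
    A * (((x * P (suc c) - P c) * P (suc d) - P (suc c) * P d) - + (suc q) * P (suc c) * P d)
  ≡⟨ cong (λ p → A * (p - + (suc q) * P (suc c) * P d)) (sym joined) ⟩
    A * (P (suc c + suc d + 1) - + (suc q) * P (suc c) * P d)
  ≡⟨ sym (cong₂ (λ a b → a ^ suc q * b) (𝐏≡pathPoly (suc d) x)
       (cong₂ _-_ (𝐏≡pathPoly (suc c + suc d + 1) x)
                  (cong₂ (λ u v → + (suc q) * u * v) (𝐏≡pathPoly (suc c) x) (𝐏≡pathPoly d x)))) ⟩
    𝐏 (suc d) x ^ suc q * (𝐏 (suc c + suc d + 1) x - + (suc q) * 𝐏 (suc c) x * 𝐏 d x)
  ∎
  where
  open ≡-Reasoning
  ds = replicate (suc (suc q)) (suc d)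
  P : ℕ → ℤ
  P = pathPoly x
  A = P (suc d) ^ suc q
  joined : P (suc c + suc d + 1) ≡ (x * P (suc c) - P c) * P (suc d) - P (suc c) * P d
  joined = trans (cong P (ℕₚ.+-comm (suc c + suc d) 1)) (pathPoly-+ x (suc (suc c)) (suc d))
  regroup : ∀ x Pc₁ Pc Pd₁ Pd A M →
    x * (Pc₁ * (Pd₁ * A)) - (Pc * (Pd₁ * A) +ℤ Pc₁ * ((+ 1 +ℤ M) * Pd * A))
      ≡ A * (((x * Pc₁ - Pc) * Pd₁ - Pc₁ * Pd) - M * Pc₁ * Pd)
  regroup = solve-∀
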